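{- Let $t \ge 1$ be an integer, $T$ a $t$-arc-bounded tournament, and $X = (X_1, \ldots, X_p)$ a jewel-chain in $T$. Then there is no arc $uv$ of $T$ with $u \in X_j$, $v \in X_i$ and $j > i$.
   Context: For an arc $e=uv$, $N(e) = N^+(v)\cap N^-(u)$. $\vec\chi$ of a tournament is the minimum number of acyclic induced subtournaments partitioning its vertex set. $T$ is $t$-arc-bounded if $\vec\chi(T[N(e)]) \le t$ for every arc $e$. Let $\ell$ be a function such that for every $k\ge1$, every tournament has either a dominating set and an absorbing set of size at most $K(k)$ (for some function $K$) or a $(k,\ell(k))$-cluster, i.e. a set $S$ with $\vec\chi(T[S]) \ge k$, $|S| \le \ell(k)$, $T[S]$ strongly connected. A jewel is a $(t+1,\ell(t+1))$-cluster. A jewel-chain of length $p$ is a sequence $(X_1,\dots,X_p)$ of pairwise disjoint vertex sets, each inducing a jewel, such that for each $1 \le i \le p-1$ all arcs between $X_i$ and $X_{i+1}$ go from $X_i$ to $X_{i+1}$. -}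

module Defs where

open import Data.Nat using (ℕ; zero; suc; _≤_; _<_)
open import Data.Fin using (Fin; toℕ)
open import Data.Fin.Subset using (Subset; _∈_; _∉_; ∣_∣)
open import Data.Product using (Σ; ∃; _×_; _,_)
open import Data.Sum using (_⊎_)
open import Data.Empty using (⊥)
open import Relation.Nullary using (¬_; Dec)
open import Relation.Binary.PropositionalEquality using (_≡_; _≢_)
open import Relation.Binary.Construct.Closure.Transitive using (TransClosure)
open import Relation.Binary.Construct.Closure.ReflexiveTransitive using (Star)

record Tournament (n : ℕ) : Set₁ where
  field
    arc     : Fin n → Fin n → Set
    arc?    : (u v : Fin n) → Dec (arc u v)
    irrefl  : ∀ u → ¬ arc u u
    antisym : ∀ u v → arc u v → arc v u → ⊥
    total   : ∀ u v → u ≢ v → arc u v ⊎ arc v u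
open Tournament public

VSet : ℕ → Set₁
VSet n = Fin n → Set

inducedArc : ∀ {n} → Tournament n → VSet n → Fin n → Fin n → Set
inducedArc T P x y = P x × P y × arc T x y

Acyclic : ∀ {n} → Tournament n → VSet n → Set
Acyclic T P = ∀ v → ¬ TransClosure (inducedArc T P) v v

-- T[P] can be partitioned into c acyclic induced subtournaments,
-- i.e. χ⃗(T[P]) ≤ c
Colourable : ∀ {n} → Tournament n → VSet n → ℕ → Set
Colourable {n} T P c =
  Σ (Fin n → ℕ) λ f →
    (∀ v → P v → f v < c) ×
    (∀ i → Acyclic T (λ v → P v × f v ≡ i))

ChiAtLeast : ∀ {n} → Tournament n → VSet n → ℕ → Set
ChiAtLeast T P k = ∀ c → Colourable T P c → k ≤ c

Nbh : ∀ {n} → Tournament n → Fin n → Fin n → VSet n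
Nbh T u v w = arc T v w × arc T w u

ArcBounded : ∀ {n} → ℕ → Tournament n → Set
ArcBounded t T = ∀ u v → arc T u v → Colourable T (Nbh T u v) t

StronglyConnected : ∀ {n} → Tournament n → VSet n → Set
StronglyConnected T P = ∀ u v → P u → P v → Star (inducedArc T P) u v

IsCluster : ∀ {n} → Tournament n → ℕ → ℕ → Subset n → Set
IsCluster T k m S =
  ChiAtLeast T (_∈ S) k × ∣ S ∣ ≤ m × StronglyConnected T (_∈ S)

Dominating : ∀ {n} → Tournament n → Subset n → Set
Dominating T D = ∀ v → v ∉ D → ∃ λ d → d ∈ D × arc T d v

Absorbing : ∀ {n} → Tournament n → Subset n → Set
Absorbing T A = ∀ v → v ∉ A → ∃ λ a → a ∈ A × arc T v a

GoodEll : (ℕ → ℕ) → Set₁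
GoodEll ℓ = Σ (ℕ → ℕ) λ K → ∀ k → 1 ≤ k → ∀ n (T : Tournament n) →
  ((∃ λ D → Dominating T D × ∣ D ∣ ≤ K k) × (∃ λ A → Absorbing T A × ∣ A ∣ ≤ K k))
  ⊎ (∃ λ S → IsCluster T k (ℓ k) S)

Jewel : ∀ {n} → (ℕ → ℕ) → ℕ → Tournament n → Subset n → Set
Jewel ℓ t T S = IsCluster T (suc t) (ℓ (suc t)) S

-- jewel-chain of length p, indexed by Fin p (X₀ , … , X_{p-1})
JewelChain : ∀ {n} → (ℕ → ℕ) → ℕ → Tournament n → (p : ℕ) → (Fin p → Subset n) → Set
JewelChain ℓ t T p X =
  (∀ i j → i ≢ j → ∀ v → v ∈ X i → v ∉ X j) ×
  (∀ i → Jewel ℓ t T (X i)) ×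
  (∀ i j → toℕ j ≡ suc (toℕ i) → ∀ x y → x ∈ X i → y ∈ X j → ¬ arc T y x)

{-# OPTIONS --safe #-}
-- Suppose u ∈ X_j, v ∈ X_i, i < j, and u → v; take such a backward arc with j − i minimal.
-- If j = i + 1 it contradicts the chain condition. Otherwise every vertex w of the jewel
-- X_{i+1} satisfies v → w (chain condition) and w → u (minimality), so X_{i+1} ⊆ N(uv).
-- Arc-boundedness then colours X_{i+1} with t colours, whereas a jewel needs t + 1.
module Submission where

open import Defs
open import Data.Nat using (ℕ; zero; suc; _≤_; _<_; _+_)
open import Data.Nat.Properties using (+-identityʳ; +-suc; m<m+n; 0<1+n; <-trans; <-irrefl; n<1+n; <⇒≢; m≤n⇒∃[o]m+o≡n)
open import Data.Fin using (Fin; toℕ; fromℕ<)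
open import Data.Fin.Properties using (toℕ-fromℕ<; toℕ<n)
open import Data.Fin.Subset using (Subset; _∈_; _∉_)
open import Data.Product using (_,_; proj₁; proj₂)
open import Data.Sum using (inj₁; inj₂)
open import Data.Empty using (⊥-elim)
open import Function.Bundles using (Equivalence)
open import Relation.Nullary using (¬_)
open import Relation.Binary.PropositionalEquality using (_≡_; _≢_; refl; sym; trans; cong; subst)
open import Relation.Binary.Construct.Closure.Transitive using (map; equivalent)

module _ {n} (T : Tournament n) where

  arc-of-¬arc : ∀ {x y} → x ≢ y → ¬ arc T y x → arc T x y
  arc-of-¬arc {x} {y} x≢y ¬y→x with total T x y x≢y
  ... | inj₁ x→y = x→y
  ... | inj₂ y→x = ⊥-elim (¬y→x y→x)

  Acyclic-antimono : {P Q : VSet n} → (∀ v → P v → Q v) → Acyclic T Q → Acyclic T P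
  Acyclic-antimono P⊆Q acyclic v cycle =
    acyclic v (Equivalence.to equivalent
      (map (λ (px , py , x→y) → P⊆Q _ px , P⊆Q _ py , x→y) (Equivalence.from equivalent cycle)))

  Colourable-antimono : ∀ {P Q : VSet n} {c} → (∀ v → P v → Q v) → Colourable T Q c → Colourable T P c
  Colourable-antimono P⊆Q (f , f<c , acyclic) =
    f , (λ v pv → f<c v (P⊆Q v pv)) ,
    (λ i → Acyclic-antimono (λ v (pv , fv≡i) → P⊆Q v pv , fv≡i) (acyclic i))

  ChiAtLeast-suc⇒¬Colourable : ∀ {P c} → ChiAtLeast T P (suc c) → ¬ Colourable T P c
  ChiAtLeast-suc⇒¬Colourable χ≥1+c colouring = <-irrefl refl (χ≥1+c _ colouring)

  jewel-⊈-Nbh : ∀ {ℓ t S u v} → ArcBounded t T → arc T u v → Jewel ℓ t T S →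
                ¬ (∀ w → w ∈ S → Nbh T u v w)
  jewel-⊈-Nbh bounded u→v jewel S⊆N =
    ChiAtLeast-suc⇒¬Colourable (proj₁ jewel) (Colourable-antimono S⊆N (bounded _ _ u→v))

module _ {n} (ℓ : ℕ → ℕ) {t} (T : Tournament n) (bounded : ArcBounded t T)
         {p} (X : Fin p → Subset n) (chain : JewelChain ℓ t T p X) where

  private
    disjoint : ∀ i j → i ≢ j → ∀ v → v ∈ X i → v ∉ X j
    disjoint = proj₁ chain

    jewel : ∀ i → Jewel ℓ t T (X i)
    jewel = proj₁ (proj₂ chain)

    forward : ∀ i j → toℕ j ≡ suc (toℕ i) → ∀ x y → x ∈ X i → y ∈ X j → ¬ arc T y x
    forward = proj₂ (proj₂ chain)

  ∈-distinct : ∀ {i j u v} → i ≢ j → u ∈ X i → v ∈ X j → u ≢ v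
  ∈-distinct i≢j u∈Xi v∈Xj refl = disjoint _ _ i≢j _ u∈Xi v∈Xj

  no-backward-arc-at-distance : ∀ d (i j : Fin p) → suc (toℕ i) + d ≡ toℕ j →
                                ∀ u v → u ∈ X j → v ∈ X i → ¬ arc T u v
  no-backward-arc-at-distance zero i j i+1≡j u v u∈Xj v∈Xi u→v =
    forward i j (trans (sym i+1≡j) (+-identityʳ _)) v u v∈Xi u∈Xj u→v
  no-backward-arc-at-distance (suc d) i j i+1+d≡j u v u∈Xj v∈Xi u→v =
    jewel-⊈-Nbh T {ℓ} bounded u→v (jewel k) λ w w∈Xk → v→w w∈Xk , w→u w∈Xk
    where
      i+1<j : suc (toℕ i) < toℕ j
      i+1<j = subst (suc (toℕ i) <_) i+1+d≡j (m<m+n _ 0<1+n)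

      k : Fin p
      k = fromℕ< (<-trans i+1<j (toℕ<n j))

      k≡i+1 : toℕ k ≡ suc (toℕ i)
      k≡i+1 = toℕ-fromℕ< _

      k+1+d≡j : suc (toℕ k) + d ≡ toℕ j
      k+1+d≡j = trans (cong (λ m → suc m + d) k≡i+1) (trans (sym (+-suc (suc (toℕ i)) d)) i+1+d≡j)

      i≢k : i ≢ k
      i≢k i≡k = <⇒≢ (n<1+n _) (trans (cong toℕ i≡k) k≡i+1)

      k≢j : k ≢ j
      k≢j k≡j = <⇒≢ (subst (_< toℕ j) (sym k≡i+1) i+1<j) (cong toℕ k≡j)

      v→w : ∀ {w} → w ∈ X k → arc T v w
      v→w w∈Xk = arc-of-¬arc T (∈-distinct i≢k v∈Xi w∈Xk) (forward i k k≡i+1 v _ v∈Xi w∈Xk)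

      w→u : ∀ {w} → w ∈ X k → arc T w u
      w→u w∈Xk = arc-of-¬arc T (∈-distinct k≢j w∈Xk u∈Xj)
                   (no-backward-arc-at-distance d k j k+1+d≡j u _ u∈Xj w∈Xk)

mainTheorem9 : (ℓ : ℕ → ℕ) → GoodEll ℓ → (t : ℕ) → 1 ≤ t → (n : ℕ) → (T : Tournament n) →
    ArcBounded t T → (p : ℕ) → (X : Fin p → Subset n) → JewelChain ℓ t T p X →
    ∀ (i j : Fin p) → toℕ i < toℕ j → ∀ u v → u ∈ X j → v ∈ X i → ¬ arc T u v
mainTheorem9 ℓ _ t _ n T bounded p X chain i j i<j
  with d , i+1+d≡j ← m≤n⇒∃[o]m+o≡n {suc (toℕ i)} {toℕ j} i<j =
  no-backward-arc-at-distance ℓ T bounded X chain d i j i+1+d≡j
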